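{- Let $\bullet$ be the one-vertex rooted tree. Then $M_\bullet(x,y,z)=1$. If $T$ is a rooted tree with branches $T_1,\dots,T_r$, then $$M_T(x,y,z)=\frac{1}{z}p_T(z)+x\sum_{i=1}^r M_{T_i}(x,y,z)\prod_{j\ne i}A_{T_j}(x,y).$$
   Context: Rooted tree: finite tree with a distinguished root. A leaf is a vertex with no children. For a rooted forest $F$, a leaf-induced subforest is a (possibly empty) union of paths from roots of $F$ to leaves of $F$; $P_F(x,y)=\sum_{F'}x^{|V(F')|}y^{|L(F')|}$ over leaf-induced subforests $F'$ (vertex and leaf counts), and $p_T(z):=1-P_T(z,-1)$ for a rooted tree $T$. A subtree of $T$ is the empty subgraph or a connected subgraph containing the root (identified with its vertex set); it is admissible if it is empty or contains no leaf of $T$; $\mathscr A(T)$ denotes the set of admissible subtrees. For a vertex set $S$, $\partial S$ is the set of vertices adjacent to $S$ but not in $S$, with $\partial\emptyset=\{\text{root}\}$. $A_T(x,y)=\sum_{T'\in\mathscr A(T)}x^{|T'|}y^{|\partial T'|}$. For a vertex $v$, the fringe subtree $T_v$ is the subtree consisting of $v$ (as root) and all its descendants, and $p_v:=p_{T_v}$. Define $M_T(x,y,z)=\sum_{T'\in\mathscr A(T)}x^{|T'|}y^{|\partial T'|-1}\sum_{v\in\partial T'}\frac{1}{z}p_v(z)$ (a polynomial, as $p_v(0)=0$). The branches of $T$ are the components of $T$ minus its root, each rooted at the child of the root it contains. -}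

module Defs where

open import Data.Nat as ℕ using (ℕ; zero; suc; _∸_)
open import Data.Integer as ℤ using (ℤ; +_; -_; _+_; _*_; _^_)
open import Data.Bool using (Bool; true; false; if_then_else_; _∧_; _∨_; not)
open import Data.List using (List; []; _∷_; map; _++_; length; cartesianProductWith; foldr; lookup; allFin; filter)
open import Data.Fin using (Fin; _≟_)
open import Relation.Nullary using (¬?)

-- Rooted trees (finite, ordered rose trees; the root is the outer node)

data Tree : Set where
  node : List Tree → Tree

• : Tree
• = node []

branches : Tree → List Tree
branches (node ts) = ts

sumℤ : List ℤ → ℤ
sumℤ = foldr _+_ (+ 0)

prodℤ : List ℤ → ℤ
prodℤ = foldr _*_ (+ 1)

-- Subtrees of T: either empty, or a connected vertex set containing the
-- root.  Such a set is the root together with, for each branch, a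
-- subtree (possibly empty) of that branch.

data Sub : Tree → Set
data Subs : List Tree → Set

data Sub where
  ∅    : ∀ {t} → Sub t
  root : ∀ {ts} → Subs ts → Sub (node ts)

data Subs where
  []  : Subs []
  _∷_ : ∀ {t ts} → Sub t → Subs ts → Subs (t ∷ ts)

subs  : (t : Tree) → List (Sub t)
subss : (ts : List Tree) → List (Subs ts)
subs (node ts) = ∅ ∷ map root (subss ts)
subss []       = [] ∷ []
subss (t ∷ ts) = cartesianProductWith _∷_ (subs t) (subss ts)

size  : ∀ {t} → Sub t → ℕ
sizes : ∀ {ts} → Subs ts → ℕ
size ∅        = 0
size (root s) = suc (sizes s)
sizes []       = 0
sizes (s ∷ ss) = size s ℕ.+ sizes ss

isEmpty : ∀ {t} → Sub t → Bool
isEmpty ∅        = true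
isEmpty (root _) = false

hasLeaf  : ∀ {t} → Sub t → Bool
hasLeafs : ∀ {ts} → Subs ts → Bool
hasLeaf ∅                 = false
hasLeaf (root {[]} _)     = true
hasLeaf (root {_ ∷ _} ss) = hasLeafs ss
hasLeafs []       = false
hasLeafs (s ∷ ss) = hasLeaf s ∨ hasLeafs ss

admissible : ∀ {t} → Sub t → Bool
admissible s = isEmpty s ∨ not (hasLeaf s)

-- The boundary ∂S, given as the list of fringe subtrees T_v, v ∈ ∂S.
-- ∂∅ = {root}; for nonempty S the vertices adjacent to S but not in S
-- are exactly the children (in T) of vertices of S not lying in S.
bd  : ∀ {t} → Sub t → List Tree
bds : ∀ {ts} → Subs ts → List Tree
bd {t} ∅  = t ∷ []
bd (root ss) = bds ss
bds []       = []
bds (s ∷ ss) = bd s ++ bds ss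

-- Leaf-induced subforests of a tree T (T viewed as a one-tree forest):
-- unions of root-to-leaf paths.  Such a union is a subtree S in which
-- every vertex of S that is not a leaf of T has a child in S.

anyNonEmpty : ∀ {ts} → Subs ts → Bool
anyNonEmpty []       = false
anyNonEmpty (s ∷ ss) = not (isEmpty s) ∨ anyNonEmpty ss

leafInduced  : ∀ {t} → Sub t → Bool
leafInduceds : ∀ {ts} → Subs ts → Bool
leafInduced ∅                 = true
leafInduced (root {[]} _)     = true
leafInduced (root {_ ∷ _} ss) = anyNonEmpty ss ∧ leafInduceds ss
leafInduceds []       = true
leafInduceds (s ∷ ss) = leafInduced s ∧ leafInduceds ss

-- number of leaves of the subforest S itself (vertices of S with no child in S)
leavesOf  : ∀ {t} → Sub t → ℕ
leavesOfs : ∀ {ts} → Subs ts → ℕ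
leavesOf ∅         = 0
leavesOf (root ss) = if anyNonEmpty ss then leavesOfs ss else 1
leavesOfs []       = 0
leavesOfs (s ∷ ss) = leavesOf s ℕ.+ leavesOfs ss

-- Univariate integer polynomials as coefficient lists [c₀, c₁, …]

Poly : Set
Poly = List ℤ

_⊕_ : Poly → Poly → Poly
[]      ⊕ q       = q
(a ∷ p) ⊕ []      = a ∷ p
(a ∷ p) ⊕ (b ∷ q) = (a + b) ∷ (p ⊕ q)

⊖_ : Poly → Poly
⊖ p = map -_ p

mono : ℕ → ℤ → Poly
mono zero    c = c ∷ []
mono (suc n) c = + 0 ∷ mono n c

-- division by z of a polynomial with zero constant term
-- (drop the constant coefficient; exact when it is 0)
divZ : Poly → Poly
divZ []      = []
divZ (_ ∷ p) = p

eval : Poly → ℤ → ℤ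
eval []      z = + 0
eval (a ∷ p) z = a + z * eval p z

-- P_T(z,-1) = Σ_{F'} z^{|V(F')|} (-1)^{|L(F')|}
PTneg1 : Tree → Poly
PTneg1 t = foldr _⊕_ [] (map term (subs t))
  where
  term : Sub t → Poly
  term s = if leafInduced s then mono (size s) ((- + 1) ^ leavesOf s) else []

pT : Tree → Poly
pT t = mono 0 (+ 1) ⊕ (⊖ PTneg1 t)

pOverZ : Tree → ℤ → ℤ
pOverZ t z = eval (divZ (pT t)) z

A : Tree → ℤ → ℤ → ℤ
A t x y = sumℤ (map w (subs t))
  where
  w : Sub t → ℤ
  w s = if admissible s then (x ^ size s) * (y ^ length (bd s)) else + 0

M : Tree → ℤ → ℤ → ℤ → ℤ
M t x y z = sumℤ (map w (subs t))
  where
  w : Sub t → ℤ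
  w s = if admissible s
        then (x ^ size s) * (y ^ (length (bd s) ∸ 1))
             * sumℤ (map (λ v → pOverZ v z) (bd s))
        else + 0

branchSum : List Tree → ℤ → ℤ → ℤ → ℤ
branchSum ts x y z =
  sumℤ (map (λ i → M (lookup ts i) x y z
                   * prodℤ (map (λ j → A (lookup ts j) x y)
                                (filter (λ j → ¬? (i ≟ j)) (allFin (length ts)))))
            (allFin (length ts)))

{-# OPTIONS --safe #-}

-- A nonempty admissible subtree of T = node ts is the root together with an
-- admissible subtree Sᵢ of every branch Tᵢ, with |T'| = 1 + Σ |Sᵢ| and
-- ∂T' = ∂S₁ ∪ … ∪ ∂Sᵣ (an empty Sᵢ contributes the root of Tᵢ).  Hence the
-- weight x^|S| y^|∂S| of A is multiplicative over the branches, while the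
-- weight of M, y^(|∂S|-1) Σ_{v ∈ ∂S} p_v/z, marks one boundary vertex and so
-- obeys the product rule: the marked vertex lies in exactly one ∂Sᵢ.  Summing
-- over all tuples (Sᵢ) gives x Σᵢ M_{Tᵢ} Π_{j≠i} A_{Tⱼ}; the empty subtree,
-- whose boundary is the root alone, contributes p_T(z)/z.

module Submission where

open import Defs
open import Data.Integer using (ℤ; +_; _+_; _*_)
open import Data.List using (List)
open import Data.Product using (_×_)
open import Data.Product using (_,_)
open import Relation.Binary.PropositionalEquality using (_≡_)

open import Data.Bool using (true; false; if_then_else_; not)
open import Data.Fin using (Fin; zero; suc; _≟_)
open import Data.Integer using (_^_)
open import Data.Integer.Properties
  using (*-zeroˡ; *-zeroʳ; *-identityˡ; +-identityˡ; +-identityʳ; +-assoc; *-distribˡ-+; *-distribʳ-+; ^-distribˡ-+-*)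
open import Data.Integer.Tactic.RingSolver using (solve-∀)
open import Data.List using ([]; _∷_; map; _++_; length; cartesianProductWith; lookup; allFin; filter; tabulate)
open import Data.List.Properties
  using (map-cong; map-∘; map-++; map-tabulate; tabulate-lookup; length-++; ++-identityʳ)
open import Data.Nat using (suc; _∸_)
open import Function using (id; _∘_)
open import Relation.Nullary using (¬?; yes; no)
open import Relation.Binary.PropositionalEquality using (refl; sym; trans; cong; cong₂; module ≡-Reasoning)
open ≡-Reasoning

sumℤ-++ : (as bs : List ℤ) → sumℤ (as ++ bs) ≡ sumℤ as + sumℤ bs
sumℤ-++ []       bs = sym (+-identityˡ (sumℤ bs))
sumℤ-++ (a ∷ as) bs = trans (cong (_+_ a) (sumℤ-++ as bs)) (sym (+-assoc a (sumℤ as) (sumℤ bs)))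

+-interchange : ∀ a b c d → (a + b) + (c + d) ≡ (a + c) + (b + d)
+-interchange = solve-∀

private variable
  X Y Z : Set

sumℤ-map-+ : (f g : X → ℤ) (us : List X) →
             sumℤ (map (λ u → f u + g u) us) ≡ sumℤ (map f us) + sumℤ (map g us)
sumℤ-map-+ f g []       = refl
sumℤ-map-+ f g (u ∷ us) =
  trans (cong (_+_ (f u + g u)) (sumℤ-map-+ f g us)) (+-interchange (f u) (g u) _ _)

sumℤ-map-*ˡ : (c : ℤ) (f : X → ℤ) (us : List X) →
              sumℤ (map (λ u → c * f u) us) ≡ c * sumℤ (map f us)
sumℤ-map-*ˡ c f []       = sym (*-zeroʳ c)
sumℤ-map-*ˡ c f (u ∷ us) =
  trans (cong (_+_ (c * f u)) (sumℤ-map-*ˡ c f us)) (sym (*-distribˡ-+ c (f u) _))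

sumℤ-map-*ʳ : (c : ℤ) (f : X → ℤ) (us : List X) →
              sumℤ (map (λ u → f u * c) us) ≡ sumℤ (map f us) * c
sumℤ-map-*ʳ c f []       = sym (*-zeroˡ c)
sumℤ-map-*ʳ c f (u ∷ us) =
  trans (cong (_+_ (f u * c)) (sumℤ-map-*ʳ c f us)) (sym (*-distribʳ-+ c (f u) _))

sumℤ-map-sumℤ-* : (f : X → ℤ) (g : Y → ℤ) (us : List X) (vs : List Y) →
                  sumℤ (map (λ u → sumℤ (map (λ v → f u * g v) vs)) us)
                    ≡ sumℤ (map f us) * sumℤ (map g vs)
sumℤ-map-sumℤ-* f g us vs =
  trans (cong sumℤ (map-cong (λ u → sumℤ-map-*ˡ (f u) g vs) us))
        (sumℤ-map-*ʳ (sumℤ (map g vs)) f us)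

sumℤ-cartesianProductWith : (h : Z → ℤ) (c : X → Y → Z) (us : List X) (vs : List Y) →
                            sumℤ (map h (cartesianProductWith c us vs))
                              ≡ sumℤ (map (λ u → sumℤ (map (λ v → h (c u v)) vs)) us)
sumℤ-cartesianProductWith h c []       vs = refl
sumℤ-cartesianProductWith h c (u ∷ us) vs = begin
    sumℤ (map h (map (c u) vs ++ cartesianProductWith c us vs))
  ≡⟨ cong sumℤ (map-++ h (map (c u) vs) _) ⟩
    sumℤ (map h (map (c u) vs) ++ map h (cartesianProductWith c us vs))
  ≡⟨ sumℤ-++ (map h (map (c u) vs)) _ ⟩
    sumℤ (map h (map (c u) vs)) + sumℤ (map h (cartesianProductWith c us vs))
  ≡⟨ cong₂ _+_ (cong sumℤ (sym (map-∘ vs))) (sumℤ-cartesianProductWith h c us vs) ⟩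
    sumℤ (map (λ v → h (c u v)) vs) + sumℤ (map (λ u → sumℤ (map (λ v → h (c u v)) vs)) us)
  ∎

leibniz : (X → ℤ) → (X → ℤ) → List X → ℤ
leibniz f g []       = + 0
leibniz f g (u ∷ us) = f u * prodℤ (map g us) + g u * leibniz f g us

others : ∀ {n} → Fin n → List (Fin n)
others {n} i = filter (λ j → ¬? (i ≟ j)) (allFin n)

allFin-suc : ∀ n → allFin (suc n) ≡ zero ∷ map suc (allFin n)
allFin-suc n = cong (zero ∷_) (sym (map-tabulate id suc))

others-zero : ∀ n → others {suc n} zero ≡ map suc (allFin n)
others-zero n = trans (cong (filter (λ j → ¬? (zero ≟ j))) (allFin-suc n)) (keepAll (allFin n))
  where
  keepAll : ∀ js → filter (λ j → ¬? (zero ≟ j)) (map suc js) ≡ map suc js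
  keepAll []       = refl
  keepAll (j ∷ js) = cong (suc j ∷_) (keepAll js)

others-suc : ∀ {n} (i : Fin n) → others (suc i) ≡ zero ∷ map suc (others i)
others-suc {n} i = trans (cong (filter (λ j → ¬? (suc i ≟ j))) (allFin-suc n)) (cong (zero ∷_) (shift (allFin n)))
  where
  shift : ∀ js → filter (λ j → ¬? (suc i ≟ j)) (map suc js) ≡ map suc (filter (λ j → ¬? (i ≟ j)) js)
  shift []       = refl
  shift (j ∷ js) with i ≟ j
  ... | yes _ = shift js
  ... | no _  = cong (suc j ∷_) (shift js)

map-lookup-allFin : (g : X → Y) (us : List X) → map (g ∘ lookup us) (allFin (length us)) ≡ map g us
map-lookup-allFin g us = begin
    map (g ∘ lookup us) (allFin (length us))
  ≡⟨ map-tabulate id (g ∘ lookup us) ⟩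
    tabulate (g ∘ lookup us)
  ≡⟨ sym (map-tabulate (lookup us) g) ⟩
    map g (tabulate (lookup us))
  ≡⟨ cong (map g) (tabulate-lookup us) ⟩
    map g us
  ∎

*-left-commute : ∀ a b c → a * (b * c) ≡ b * (a * c)
*-left-commute = solve-∀

module _ (f g : X → ℤ) where

  omitting : (us : List X) → Fin (length us) → ℤ
  omitting us i = f (lookup us i) * prodℤ (map (g ∘ lookup us) (others i))

  sumℤ-omitting≡leibniz : ∀ us → sumℤ (map (omitting us) (allFin (length us))) ≡ leibniz f g us
  sumℤ-omitting≡leibniz []       = refl
  sumℤ-omitting≡leibniz (u ∷ us) = begin
      sumℤ (map (omitting (u ∷ us)) (allFin (suc n)))
    ≡⟨ cong (sumℤ ∘ map (omitting (u ∷ us))) (allFin-suc n) ⟩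
      omitting (u ∷ us) zero + sumℤ (map (omitting (u ∷ us)) (map suc (allFin n)))
    ≡⟨ cong₂ _+_ omitting-zero (cong sumℤ (sym (map-∘ (allFin n)))) ⟩
      f u * prodℤ (map g us) + sumℤ (map (omitting (u ∷ us) ∘ suc) (allFin n))
    ≡⟨ cong (_+_ (f u * prodℤ (map g us)))
            (trans (cong sumℤ (map-cong omitting-suc (allFin n))) (sumℤ-map-*ˡ (g u) (omitting us) (allFin n))) ⟩
      f u * prodℤ (map g us) + g u * sumℤ (map (omitting us) (allFin n))
    ≡⟨ cong (λ d → f u * prodℤ (map g us) + g u * d) (sumℤ-omitting≡leibniz us) ⟩
      leibniz f g (u ∷ us)
    ∎
    where
    n = length us

    omitting-zero : omitting (u ∷ us) zero ≡ f u * prodℤ (map g us)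
    omitting-zero = cong (λ as → f u * prodℤ as) (begin
        map (g ∘ lookup (u ∷ us)) (others zero)
      ≡⟨ cong (map (g ∘ lookup (u ∷ us))) (others-zero n) ⟩
        map (g ∘ lookup (u ∷ us)) (map suc (allFin n))
      ≡⟨ sym (map-∘ (allFin n)) ⟩
        map (g ∘ lookup us) (allFin n)
      ≡⟨ map-lookup-allFin g us ⟩
        map g us
      ∎)

    omitting-suc : ∀ i → omitting (u ∷ us) (suc i) ≡ g u * omitting us i
    omitting-suc i = begin
        f (lookup us i) * prodℤ (map (g ∘ lookup (u ∷ us)) (others (suc i)))
      ≡⟨ cong (λ js → f (lookup us i) * prodℤ (map (g ∘ lookup (u ∷ us)) js)) (others-suc i) ⟩
        f (lookup us i) * (g u * prodℤ (map (g ∘ lookup (u ∷ us)) (map suc (others i))))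
      ≡⟨ cong (λ as → f (lookup us i) * (g u * prodℤ as)) (sym (map-∘ (others i))) ⟩
        f (lookup us i) * (g u * prodℤ (map (g ∘ lookup us) (others i)))
      ≡⟨ *-left-commute (f (lookup us i)) (g u) _ ⟩
        g u * omitting us i
      ∎

admissible≡not-hasLeaf : ∀ {t} (s : Sub t) → admissible s ≡ not (hasLeaf s)
admissible≡not-hasLeaf ∅        = refl
admissible≡not-hasLeaf (root _) = refl

pOverZ-• : ∀ z → pOverZ • z ≡ + 1
pOverZ-• z = trans (cong (_+_ (+ 1)) (*-zeroʳ z)) (+-identityʳ (+ 1))

module Weights (x y z : ℤ) where

  sumPOverZ : List Tree → ℤ
  sumPOverZ vs = sumℤ (map (λ v → pOverZ v z) vs)

  -- The truncated |vs| ∸ 1 is harmless because sumPOverZ [] = 0, so the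
  -- product rule markedWeight-++ needs no nonemptiness hypothesis.
  markedWeight : List Tree → ℤ
  markedWeight vs = y ^ (length vs ∸ 1) * sumPOverZ vs

  sumPOverZ-++ : ∀ us vs → sumPOverZ (us ++ vs) ≡ sumPOverZ us + sumPOverZ vs
  sumPOverZ-++ us vs = trans (cong sumℤ (map-++ (λ v → pOverZ v z) us vs)) (sumℤ-++ (map (λ v → pOverZ v z) us) _)

  markedWeight-++ : ∀ us vs → markedWeight (us ++ vs) ≡ markedWeight us * y ^ length vs + y ^ length us * markedWeight vs
  markedWeight-++ []       vs = ring (markedWeight vs) (y ^ length vs)
    where
    ring : ∀ m q → m ≡ + 0 * q + + 1 * m
    ring = solve-∀
  markedWeight-++ (u ∷ us) [] rewrite ++-identityʳ us = ring (markedWeight (u ∷ us)) (y ^ length (u ∷ us))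
    where
    ring : ∀ m p → m ≡ m * + 1 + p * + 0
    ring = solve-∀
  markedWeight-++ (u ∷ us) (v ∷ vs) = begin
      y ^ length (us ++ v ∷ vs) * sumPOverZ ((u ∷ us) ++ v ∷ vs)
    ≡⟨ cong₂ _*_ (trans (cong (y ^_) (length-++ us)) (^-distribˡ-+-* y (length us) (length (v ∷ vs))))
                 (sumPOverZ-++ (u ∷ us) (v ∷ vs)) ⟩
      y ^ length us * (y * y ^ length vs) * (sumPOverZ (u ∷ us) + sumPOverZ (v ∷ vs))
    ≡⟨ ring y (y ^ length us) (y ^ length vs) (sumPOverZ (u ∷ us)) (sumPOverZ (v ∷ vs)) ⟩
      markedWeight (u ∷ us) * y ^ length (v ∷ vs) + y ^ length (u ∷ us) * markedWeight (v ∷ vs)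
    ∎
    where
    ring : ∀ y p q s t → p * (y * q) * (s + t) ≡ p * s * (y * q) + y * p * (q * t)
    ring = solve-∀

  weightA : ∀ {t} → Sub t → ℤ
  weightA s = if admissible s then x ^ size s * y ^ length (bd s) else + 0

  weightM : ∀ {t} → Sub t → ℤ
  weightM s = if admissible s then x ^ size s * y ^ (length (bd s) ∸ 1) * sumPOverZ (bd s) else + 0

  weightsA : ∀ {ts} → Subs ts → ℤ
  weightsA ss = if hasLeafs ss then + 0 else x ^ sizes ss * y ^ length (bds ss)

  weightsM : ∀ {ts} → Subs ts → ℤ
  weightsM ss = if hasLeafs ss then + 0 else x ^ sizes ss * markedWeight (bds ss)

  weightsA-∷ : ∀ {t ts} (s : Sub t) (ss : Subs ts) → weightsA (s ∷ ss) ≡ weightA s * weightsA ss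
  weightsA-∷ s ss rewrite admissible≡not-hasLeaf s with hasLeaf s | hasLeafs ss
  ... | true  | _     = sym (*-zeroˡ (weightsA ss))
  ... | false | true  = sym (*-zeroʳ (x ^ size s * y ^ length (bd s)))
  ... | false | false
    rewrite ^-distribˡ-+-* x (size s) (sizes ss)
          | length-++ (bd s) {bds ss}
          | ^-distribˡ-+-* y (length (bd s)) (length (bds ss))
    = ring (x ^ size s) (x ^ sizes ss) (y ^ length (bd s)) (y ^ length (bds ss))
    where
    ring : ∀ a b c d → a * b * (c * d) ≡ a * c * (b * d)
    ring = solve-∀

  weightsM-∷ : ∀ {t ts} (s : Sub t) (ss : Subs ts) →
               weightsM (s ∷ ss) ≡ weightM s * weightsA ss + weightA s * weightsM ss
  weightsM-∷ s ss rewrite admissible≡not-hasLeaf s with hasLeaf s | hasLeafs ss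
  ... | true  | _     = sym (cong₂ _+_ (*-zeroˡ (weightsA ss)) (*-zeroˡ (weightsM ss)))
  ... | false | true  = sym (cong₂ _+_ (*-zeroʳ (x ^ size s * y ^ (length (bd s) ∸ 1) * sumPOverZ (bd s)))
                                     (*-zeroʳ (x ^ size s * y ^ length (bd s))))
  ... | false | false
    rewrite ^-distribˡ-+-* x (size s) (sizes ss) | markedWeight-++ (bd s) (bds ss)
    = ring (x ^ size s) (x ^ sizes ss) (y ^ (length (bd s) ∸ 1)) (sumPOverZ (bd s))
           (y ^ length (bd s)) (y ^ length (bds ss)) (markedWeight (bds ss))
    where
    ring : ∀ a b c s p q m → a * b * (c * s * q + p * m) ≡ a * c * s * (b * q) + a * p * (b * m)
    ring = solve-∀

  weightM-∅ : ∀ {t} → weightM {t} ∅ ≡ pOverZ t z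
  weightM-∅ {t} = trans (*-identityˡ (pOverZ t z + + 0)) (+-identityʳ (pOverZ t z))

  weightM-root : ∀ {ts} (ss : Subs ts) → weightM (root ss) ≡ x * weightsM ss
  weightM-root {[]}    [] = sym (*-zeroʳ x)
  weightM-root {_ ∷ _} ss with hasLeafs ss
  ... | true  = sym (*-zeroʳ x)
  ... | false = ring x (x ^ sizes ss) (y ^ (length (bds ss) ∸ 1)) (sumPOverZ (bds ss))
    where
    ring : ∀ x a c s → x * a * c * s ≡ x * (a * (c * s))
    ring = solve-∀

  sumℤ-weightsA : ∀ ts → sumℤ (map weightsA (subss ts)) ≡ prodℤ (map (λ t → A t x y) ts)
  sumℤ-weightsA []       = refl
  sumℤ-weightsA (t ∷ ts) = begin
      sumℤ (map weightsA (cartesianProductWith _∷_ (subs t) (subss ts)))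
    ≡⟨ sumℤ-cartesianProductWith weightsA _∷_ (subs t) (subss ts) ⟩
      sumℤ (map (λ s → sumℤ (map (λ ss → weightsA (s ∷ ss)) (subss ts))) (subs t))
    ≡⟨ cong sumℤ (map-cong (λ s → cong sumℤ (map-cong (weightsA-∷ s) (subss ts))) (subs t)) ⟩
      sumℤ (map (λ s → sumℤ (map (λ ss → weightA s * weightsA ss) (subss ts))) (subs t))
    ≡⟨ sumℤ-map-sumℤ-* weightA weightsA (subs t) (subss ts) ⟩
      A t x y * sumℤ (map weightsA (subss ts))
    ≡⟨ cong (A t x y *_) (sumℤ-weightsA ts) ⟩
      A t x y * prodℤ (map (λ t → A t x y) ts)
    ∎

  sumℤ-weightsM : ∀ ts → sumℤ (map weightsM (subss ts)) ≡ leibniz (λ t → M t x y z) (λ t → A t x y) ts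
  sumℤ-weightsM []       = refl
  sumℤ-weightsM (t ∷ ts) = begin
      sumℤ (map weightsM (cartesianProductWith _∷_ (subs t) (subss ts)))
    ≡⟨ sumℤ-cartesianProductWith weightsM _∷_ (subs t) (subss ts) ⟩
      sumℤ (map (λ s → sumℤ (map (λ ss → weightsM (s ∷ ss)) (subss ts))) (subs t))
    ≡⟨ cong sumℤ (map-cong (λ s → trans (cong sumℤ (map-cong (weightsM-∷ s) (subss ts)))
                                         (sumℤ-map-+ (λ ss → weightM s * weightsA ss) (λ ss → weightA s * weightsM ss) (subss ts)))
                           (subs t)) ⟩
      sumℤ (map (λ s → sumℤ (map (λ ss → weightM s * weightsA ss) (subss ts))
                     + sumℤ (map (λ ss → weightA s * weightsM ss) (subss ts))) (subs t))
    ≡⟨ sumℤ-map-+ _ _ (subs t) ⟩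
      sumℤ (map (λ s → sumℤ (map (λ ss → weightM s * weightsA ss) (subss ts))) (subs t))
        + sumℤ (map (λ s → sumℤ (map (λ ss → weightA s * weightsM ss) (subss ts))) (subs t))
    ≡⟨ cong₂ _+_ (sumℤ-map-sumℤ-* weightM weightsA (subs t) (subss ts))
                 (sumℤ-map-sumℤ-* weightA weightsM (subs t) (subss ts)) ⟩
      M t x y z * sumℤ (map weightsA (subss ts)) + A t x y * sumℤ (map weightsM (subss ts))
    ≡⟨ cong₂ (λ p d → M t x y z * p + A t x y * d) (sumℤ-weightsA ts) (sumℤ-weightsM ts) ⟩
      leibniz (λ t → M t x y z) (λ t → A t x y) (t ∷ ts)
    ∎

  M-node : ∀ ts → M (node ts) x y z ≡ pOverZ (node ts) z + x * leibniz (λ t → M t x y z) (λ t → A t x y) ts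
  M-node ts = cong₂ _+_ (weightM-∅ {node ts}) (begin
      sumℤ (map weightM (map root (subss ts)))
    ≡⟨ cong sumℤ (sym (map-∘ (subss ts))) ⟩
      sumℤ (map (weightM ∘ root) (subss ts))
    ≡⟨ cong sumℤ (map-cong weightM-root (subss ts)) ⟩
      sumℤ (map (λ ss → x * weightsM ss) (subss ts))
    ≡⟨ sumℤ-map-*ˡ x weightsM (subss ts) ⟩
      x * sumℤ (map weightsM (subss ts))
    ≡⟨ cong (x *_) (sumℤ-weightsM ts) ⟩
      x * leibniz (λ t → M t x y z) (λ t → A t x y) ts
    ∎)

open Weights using (M-node)

branchSum≡leibniz : ∀ ts x y z → branchSum ts x y z ≡ leibniz (λ t → M t x y z) (λ t → A t x y) ts
branchSum≡leibniz ts x y z = sumℤ-omitting≡leibniz (λ t → M t x y z) (λ t → A t x y) ts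

lemma4p4 : ((x y z : ℤ) → M • x y z ≡ + 1)
    × ((ts : List Tree) (x y z : ℤ) →
         M (node ts) x y z ≡ pOverZ (node ts) z + x * branchSum ts x y z)
lemma4p4 = M-• , M-node-branchSum
  where
  M-• : (x y z : ℤ) → M • x y z ≡ + 1
  M-• x y z = begin
      M • x y z                  ≡⟨ M-node x y z [] ⟩
      pOverZ • z + x * + 0       ≡⟨ cong (_+_ (pOverZ • z)) (*-zeroʳ x) ⟩
      pOverZ • z + + 0           ≡⟨ +-identityʳ (pOverZ • z) ⟩
      pOverZ • z                 ≡⟨ pOverZ-• z ⟩
      + 1                        ∎

  M-node-branchSum : (ts : List Tree) (x y z : ℤ) →
                     M (node ts) x y z ≡ pOverZ (node ts) z + x * branchSum ts x y z
  M-node-branchSum ts x y z =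
    trans (M-node x y z ts) (cong (λ b → pOverZ (node ts) z + x * b) (sym (branchSum≡leibniz ts x y z)))
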